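{- Let $M$ be an $m\times n$ gridding matrix whose row-column graph $G_M$ contains a cycle $C$ of length $\ell$. Consider the $2\ell$ vertices of $G_{M^{\times2}}$ arising from the vertices of $C$, together with the $2\ell$ edges of $G_{M^{\times 2}}$ arising from the edges of $C$. (i) If $C$ has positive sign, these form two disjoint cycles, each of length $\ell$ and of positive sign. (ii) If $C$ has negative sign, these form a single cycle of length $2\ell$, of positive sign.
   Context: A gridding matrix is a matrix with entries in $\{0,1,-1\}$; an $m\times n$ gridding matrix has $m$ columns and $n$ rows, and $M_{ij}$ is the entry in column $i$ from the left and row $j$ from the bottom. The row-column graph $G_M$ is the bipartite graph with column vertices $1,\dots,m$ and row vertices $1',\dots,n'$ and an edge $ij'$ iff $M_{ij}\neq0$. The sign of a cycle $C$ of $G_M$ is $\prod_{ij'\in E(C)}M_{ij}$. The doubling $M^{\times2}$ is the $2m\times 2n$ gridding matrix obtained by replacing each entry $M_{ij}$ by a $2\times 2$ block occupying columns $2i-1,2i$ and rows $2j-1,2j$: for $M_{ij}=0$ the zero block; for $M_{ij}=1$ the block with $1$ in (column $2i-1$, row $2j-1$) and (column $2i$, row $2j$) and $0$ elsewhere; for $M_{ij}=-1$ the block with $-1$ in (column $2i-1$, row $2j$) and (column $2i$, row $2j-1$) and $0$ elsewhere. Column vertex $i$ of $G_M$ gives rise to column vertices $2i-1,2i$ of $G_{M^{\times2}}$, row vertex $j'$ to row vertices $(2j-1)',(2j)'$, and edge $ij'$ to the two edges of $G_{M^{\times2}}$ corresponding to the two nonzero entries of the block replacing $M_{ij}$. 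-}

module Defs where

open import Data.Nat as ℕ using (ℕ; zero; suc; _≤_; _<?_)
open import Data.Fin as Fin using (Fin; toℕ; fromℕ<; quotient; remainder)
open import Data.Integer as ℤ using (ℤ; 0ℤ; 1ℤ; -1ℤ)
open import Data.Product using (Σ; ∃; _×_; _,_)
open import Data.Sum using (_⊎_)
open import Relation.Nullary using (¬_; yes; no)
open import Relation.Binary.PropositionalEquality using (_≡_)
open import Function.Definitions using (Injective)

data Entry : Set where
  𝟘 𝟙 -𝟙 : Entry

toℤ : Entry → ℤ
toℤ 𝟘  = 0ℤ
toℤ 𝟙  = 1ℤ
toℤ -𝟙 = -1ℤ

-- An m × n gridding matrix: m columns (Fin m), n rows (Fin n);
-- M i j is the entry in column i and row j (0-based, from left / bottom).
GriddingMatrix : ℕ → ℕ → Set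
GriddingMatrix m n = Fin m → Fin n → Entry

NonZero : Entry → Set
NonZero e = ¬ (e ≡ 𝟘)

data Vertex (m n : ℕ) : Set where
  colV : Fin m → Vertex m n
  rowV : Fin n → Vertex m n

-- An edge i j' of G_M is recorded by the pair (i , j) (with M i j ≠ 0).
EdgeIx : ℕ → ℕ → Set
EdgeIx m n = Fin m × Fin n

IsEdge : ∀ {m n} → GriddingMatrix m n → EdgeIx m n → Set
IsEdge M (i , j) = NonZero (M i j)

next : ∀ {k} → Fin k → Fin k
next {suc k} i with suc (toℕ i) <? suc k
... | yes p = fromℕ< p
... | no _  = Fin.zero

∏ : ∀ k → (Fin k → ℤ) → ℤ
∏ zero    f = 1ℤ
∏ (suc k) f = f Fin.zero ℤ.* ∏ k (λ t → f (Fin.suc t))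

-- Since G_M is bipartite a
-- cycle alternates between column and row vertices; it is the closed walk
--   col 0 , row 0 , col 1 , row 1 , … , col (k-1) , row (k-1) , col 0
-- with k ≥ 2 distinct column vertices and k distinct row vertices, so it has
-- length 2k and its edges are (col t , row t) and (col (t+1 mod k) , row t).
record Cycle {m n : ℕ} (M : GriddingMatrix m n) : Set where
  field
    k       : ℕ
    2≤k     : 2 ≤ k
    col     : Fin k → Fin m
    row     : Fin k → Fin n
    col-inj : Injective _≡_ _≡_ col
    row-inj : Injective _≡_ _≡_ row
    edgeA   : ∀ t → IsEdge M (col t , row t)
    edgeB   : ∀ t → IsEdge M (col (next t) , row t)

module _ {m n : ℕ} {M : GriddingMatrix m n} where
  open Cycle

  cycleLength : Cycle M → ℕ
  cycleLength C = 2 ℕ.* k C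

  VSet : Cycle M → Vertex m n → Set
  VSet C (colV i) = ∃ λ t → col C t ≡ i
  VSet C (rowV j) = ∃ λ t → row C t ≡ j

  ESet : Cycle M → EdgeIx m n → Set
  ESet C e = ∃ λ t → ((col C t , row C t) ≡ e) ⊎ ((col C (next t) , row C t) ≡ e)

  sign : Cycle M → ℤ
  sign C = ∏ (k C) (λ t → toℤ (M (col C t) (row C t)) ℤ.* toℤ (M (col C (next t)) (row C t)))

-- The 2×2 block replacing an entry; arguments: entry, local column (0/1),
-- local row (0/1).  (0-based local index 0 ↔ column/row 2i-1, 1 ↔ 2i.)
block : Entry → Fin 2 → Fin 2 → Entry
block 𝟘  _ _ = 𝟘
block 𝟙  Fin.zero       Fin.zero       = 𝟙
block 𝟙  (Fin.suc Fin.zero) (Fin.suc Fin.zero) = 𝟙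
block 𝟙  _ _ = 𝟘
block -𝟙 Fin.zero       (Fin.suc Fin.zero) = -𝟙
block -𝟙 (Fin.suc Fin.zero) Fin.zero       = -𝟙
block -𝟙 _ _ = 𝟘

-- The doubling M^{×2}: a (2m)×(2n) gridding matrix.  Column c of M^{×2}
-- (0-based, c = 2i + a with a ∈ {0,1}) lies in block column i = quotient 2 c.
double : ∀ {m n} → GriddingMatrix m n → GriddingMatrix (m ℕ.* 2) (n ℕ.* 2)
double {m} {n} M c r =
  block (M (quotient {m} 2 c) (quotient {n} 2 r)) (remainder {m} 2 c) (remainder {n} 2 r)

parentV : ∀ {m n} → Vertex (m ℕ.* 2) (n ℕ.* 2) → Vertex m n
parentV {m} (colV c) = colV (quotient {m} 2 c)
parentV {n = n} (rowV r) = rowV (quotient {n} 2 r)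

liftV : ∀ {m n} {M : GriddingMatrix m n} → Cycle M → Vertex (m ℕ.* 2) (n ℕ.* 2) → Set
liftV C v = VSet C (parentV v)

-- the 2ℓ edges of G_{M^{×2}} arising from the edges of C: the edges of
-- G_{M^{×2}} (nonzero entries) lying in a block replacing an edge of C
liftE : ∀ {m n} {M : GriddingMatrix m n} → Cycle M → EdgeIx (m ℕ.* 2) (n ℕ.* 2) → Set
liftE {m} {n} {M} C (c , r) = ESet C (quotient {m} 2 c , quotient {n} 2 r) × IsEdge (double M) (c , r)

-- Record an entry by its twist, 0 for 1 and 1 for -1: the nonzero cells of the block replacing a
-- nonzero entry e are exactly (a , a ⊕ twist e) for a layer a ∈ Fin 2.  So the vertices of G_{M×2}
-- above C are indexed by positions (s , a) ∈ Fin k × Fin 2, and the lifted edges lead from layer a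
-- over the s-th column vertex of C to layer a ⊕ turn s over the next one, where turn s is the xor of
-- the twists of the two edges of C at s.  Going once around C shifts the layer by the xor of all
-- turns, which is 0 exactly when C is positive.  Hence the lifted vertices and edges make up the
-- cycles traced by the orbits of (s , a) ↦ (next s , a ⊕ turn s): two orbits (sheets) of length k
-- when C is positive, one orbit of length 2k otherwise.  Every cycle of a doubling is positive,
-- since the layers of its column vertices come back to where they started.
{-# OPTIONS --safe #-}
module Submission where

open import Defs
open import Data.Nat using (ℕ; _*_)
open import Data.Integer using (1ℤ; -1ℤ)
open import Data.Product using (Σ; _×_; _,_)
open import Data.Sum using (_⊎_)
open import Data.Empty using (⊥)
open import Relation.Binary.PropositionalEquality using (_≡_)
open import Function.Bundles using (_⇔_)

open import Data.Nat as ℕ using (suc; _≤_; _<?_)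
open import Data.Nat.Properties using (+-suc; +-identityʳ; <-irrefl; ≤-trans; m≤m+n)
open import Data.Fin using (Fin; zero; suc; toℕ; fromℕ; inject₁; combine; remQuot; quotient; remainder)
open import Data.Fin.Properties
  using (toℕ-injective; toℕ<n; toℕ-fromℕ; toℕ-fromℕ<; toℕ-inject₁; toℕ-↑ˡ; toℕ-↑ʳ; toℕ-combine;
         remQuot-combine; combine-remQuot; combine-injective; 0≢1+n)
open import Data.Fin.Induction using (<-weakInduction)
open import Data.Fin.Relation.Unary.Top using (view; ‵fromℕ; ‵inject₁)
open import Data.Integer as ℤ using (ℤ)
open import Data.Product using (∃; proj₁; proj₂; uncurry)
open import Data.Product.Properties using (,-injective; ,-injectiveˡ; ,-injectiveʳ)
open import Data.Sum as Sum using (inj₁; inj₂; [_,_])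
open import Data.Empty using (⊥-elim)
open import Function.Base using (_∘_)
open import Function.Bundles using (mk⇔)
open import Function.Definitions using (Injective)
open import Relation.Nullary using (yes; no)
open import Relation.Binary.PropositionalEquality
  using (refl; sym; trans; cong; cong₂; subst; module ≡-Reasoning)

open ≡-Reasoning

infixl 6 _⊕_

_⊕_ : Fin 2 → Fin 2 → Fin 2
zero     ⊕ b        = b
suc zero ⊕ zero     = suc zero
suc zero ⊕ suc zero = zero

⊕-identityʳ : ∀ a → a ⊕ zero ≡ a
⊕-identityʳ zero       = refl
⊕-identityʳ (suc zero) = refl

⊕-assoc : ∀ a b c → a ⊕ b ⊕ c ≡ a ⊕ (b ⊕ c)
⊕-assoc zero       b          c          = refl
⊕-assoc (suc zero) zero       c          = refl
⊕-assoc (suc zero) (suc zero) zero       = refl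
⊕-assoc (suc zero) (suc zero) (suc zero) = refl

a⊕b⊕b≡a : ∀ a b → a ⊕ b ⊕ b ≡ a
a⊕b⊕b≡a a          zero       = trans (⊕-identityʳ _) (⊕-identityʳ a)
a⊕b⊕b≡a zero       (suc zero) = refl
a⊕b⊕b≡a (suc zero) (suc zero) = refl

⊕-cancelʳ : ∀ a b c → a ⊕ c ≡ b ⊕ c → a ≡ b
⊕-cancelʳ a b c eq = begin
  a         ≡⟨ sym (a⊕b⊕b≡a a c) ⟩
  a ⊕ c ⊕ c ≡⟨ cong (_⊕ c) eq ⟩
  b ⊕ c ⊕ c ≡⟨ a⊕b⊕b≡a b c ⟩
  b         ∎

a⊕b⊕[b⊕c]≡a⊕c : ∀ a b c → a ⊕ b ⊕ (b ⊕ c) ≡ a ⊕ c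
a⊕b⊕[b⊕c]≡a⊕c a b c = begin
  a ⊕ b ⊕ (b ⊕ c) ≡⟨ sym (⊕-assoc (a ⊕ b) b c) ⟩
  a ⊕ b ⊕ b ⊕ c   ≡⟨ cong (_⊕ c) (a⊕b⊕b≡a a b) ⟩
  a ⊕ c           ∎

a≡a⊕b⇒b≡0 : ∀ a b → a ≡ a ⊕ b → b ≡ zero
a≡a⊕b⇒b≡0 zero       b    eq = sym eq
a≡a⊕b⇒b≡0 (suc zero) zero _  = refl
a≡a⊕b⇒b≡0 (suc zero) (suc zero) ()

Fin2-⊎ : (P : Fin 2 → Set) → ∀ a → P a → P zero ⊎ P (suc zero)
Fin2-⊎ P zero       = inj₁
Fin2-⊎ P (suc zero) = inj₂

twist : Entry → Fin 2
twist 𝟘  = zero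
twist 𝟙  = zero
twist -𝟙 = suc zero

-1^_ : Fin 2 → ℤ
-1^ zero       = 1ℤ
-1^ (suc zero) = -1ℤ

-1^-⊕ : ∀ a b → -1^ (a ⊕ b) ≡ -1^ a ℤ.* -1^ b
-1^-⊕ zero       zero       = refl
-1^-⊕ zero       (suc zero) = refl
-1^-⊕ (suc zero) zero       = refl
-1^-⊕ (suc zero) (suc zero) = refl

-1^≡1⇒≡0 : ∀ a → -1^ a ≡ 1ℤ → a ≡ zero
-1^≡1⇒≡0 zero       _ = refl
-1^≡1⇒≡0 (suc zero) ()

-1^≡-1⇒≡1 : ∀ a → -1^ a ≡ -1ℤ → a ≡ suc zero
-1^≡-1⇒≡1 zero       ()
-1^≡-1⇒≡1 (suc zero) _ = refl

toℤ≡-1^twist : ∀ e → NonZero e → toℤ e ≡ -1^ twist e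
toℤ≡-1^twist 𝟘  nz = ⊥-elim (nz refl)
toℤ≡-1^twist 𝟙  _  = refl
toℤ≡-1^twist -𝟙 _  = refl

block-on-support : ∀ {e a b} → NonZero e → b ≡ a ⊕ twist e → NonZero (block e a b)
block-on-support {𝟘}                 nz _    = ⊥-elim (nz refl)
block-on-support {𝟙}    {zero}       _  refl ()
block-on-support {𝟙}    {suc zero}   _  refl ()
block-on-support { -𝟙 } {zero}       _  refl ()
block-on-support { -𝟙 } {suc zero}   _  refl ()

block-nonzero : ∀ e a b → NonZero (block e a b) → block e a b ≡ e × b ≡ a ⊕ twist e
block-nonzero 𝟘  _          _          nz = ⊥-elim (nz refl)
block-nonzero 𝟙  zero       zero       _  = refl , refl
block-nonzero 𝟙  zero       (suc zero) nz = ⊥-elim (nz refl)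
block-nonzero 𝟙  (suc zero) zero       nz = ⊥-elim (nz refl)
block-nonzero 𝟙  (suc zero) (suc zero) _  = refl , refl
block-nonzero -𝟙 zero       zero       nz = ⊥-elim (nz refl)
block-nonzero -𝟙 zero       (suc zero) _  = refl , refl
block-nonzero -𝟙 (suc zero) zero       _  = refl , refl
block-nonzero -𝟙 (suc zero) (suc zero) nz = ⊥-elim (nz refl)

quotient-combine : ∀ {m n} (i : Fin m) (j : Fin n) → quotient {m} n (combine i j) ≡ i
quotient-combine i j = cong proj₁ (remQuot-combine i j)

remQuot-injective : ∀ {m} n → Injective _≡_ _≡_ (remQuot {m} n)
remQuot-injective {m} n {t} {u} eq = begin
  t                                 ≡⟨ sym (combine-remQuot {m} n t) ⟩
  uncurry combine (remQuot {m} n t) ≡⟨ cong (uncurry combine) eq ⟩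
  uncurry combine (remQuot {m} n u) ≡⟨ combine-remQuot {m} n u ⟩
  u                                 ∎

module _ {m n} (M : GriddingMatrix m n) where

  double-combine : ∀ i a j b → double M (combine i a) (combine j b) ≡ block (M i j) a b
  double-combine i a j b =
    cong₂ (λ p q → block (M (proj₁ p) (proj₁ q)) (proj₂ p) (proj₂ q))
          (remQuot-combine i a) (remQuot-combine j b)

  module _ {c r} (nz : IsEdge (double M) (c , r)) where

    twist-double : twist (double M c r) ≡ twist (M (quotient {m} 2 c) (quotient {n} 2 r))
    twist-double = cong twist (proj₁ (block-nonzero _ _ _ nz))

    layers-double : remainder {n} 2 r ≡ remainder {m} 2 c ⊕ twist (M (quotient {m} 2 c) (quotient {n} 2 r))
    layers-double = proj₂ (block-nonzero _ _ _ nz)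

next-suc : ∀ {k} (t u : Fin k) → toℕ u ≡ suc (toℕ t) → next t ≡ u
next-suc {suc k} t u u≡1+t with suc (toℕ t) <? suc k
... | yes p = toℕ-injective (trans (toℕ-fromℕ< p) (sym u≡1+t))
... | no ¬p = ⊥-elim (¬p (subst (ℕ._< suc k) u≡1+t (toℕ<n u)))

next-last : ∀ {k} (t : Fin (suc k)) → toℕ t ≡ k → next t ≡ zero
next-last {k} t t≡k with suc (toℕ t) <? suc k
... | yes p = ⊥-elim (<-irrefl (cong suc t≡k) p)
... | no _  = refl

next-inject₁ : ∀ {k} (u : Fin k) → next (inject₁ u) ≡ suc u
next-inject₁ u = next-suc (inject₁ u) (suc u) (cong suc (sym (toℕ-inject₁ u)))

next-fromℕ : ∀ k → next (fromℕ k) ≡ zero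
next-fromℕ k = next-last (fromℕ k) (toℕ-fromℕ k)

next-combine-inject₁ : ∀ {k} (b : Fin 2) (u : Fin k) → next (combine {2} {suc k} b (inject₁ u)) ≡ combine b (suc u)
next-combine-inject₁ {k} b u = next-suc _ _ (begin
  toℕ (combine b (suc u))                  ≡⟨ toℕ-combine b (suc u) ⟩
  suc k * toℕ b ℕ.+ suc (toℕ u)            ≡⟨ +-suc (suc k * toℕ b) (toℕ u) ⟩
  suc (suc k * toℕ b ℕ.+ toℕ u)            ≡⟨ cong (λ x → suc (suc k * toℕ b ℕ.+ x)) (sym (toℕ-inject₁ u)) ⟩
  suc (suc k * toℕ b ℕ.+ toℕ (inject₁ u))  ≡⟨ cong suc (sym (toℕ-combine b (inject₁ u))) ⟩
  suc (toℕ (combine b (inject₁ u)))        ∎)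

next-combine-fromℕ : ∀ {k} (b : Fin 2) → next (combine {2} {suc k} b (fromℕ k)) ≡ combine (b ⊕ suc zero) zero
next-combine-fromℕ {k} zero = next-suc _ _ (begin
  toℕ (combine {2} {suc k} (suc zero) zero)  ≡⟨ toℕ-↑ʳ (suc k) zero ⟩
  suc k ℕ.+ 0                               ≡⟨ +-identityʳ (suc k) ⟩
  suc k                                     ≡⟨ cong suc (sym (toℕ-fromℕ k)) ⟩
  suc (toℕ (fromℕ k))                       ≡⟨ cong suc (sym (toℕ-↑ˡ (fromℕ k) _)) ⟩
  suc (toℕ (combine {2} zero (fromℕ k)))    ∎)
next-combine-fromℕ {k} (suc zero) = next-last _ (begin
  toℕ (combine {2} (suc zero) (fromℕ k))    ≡⟨ toℕ-↑ʳ (suc k) _ ⟩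
  suc k ℕ.+ toℕ (combine {1} zero (fromℕ k)) ≡⟨ cong (suc k ℕ.+_) (toℕ-↑ˡ (fromℕ k) 0) ⟩
  suc k ℕ.+ toℕ (fromℕ k)                   ≡⟨ cong (suc k ℕ.+_) (trans (toℕ-fromℕ k) (sym (+-identityʳ k))) ⟩
  suc (k ℕ.+ (k ℕ.+ 0))                     ≡⟨ sym (+-suc k (k ℕ.+ 0)) ⟩
  k ℕ.+ suc (k ℕ.+ 0)                       ∎)

total : ∀ {k} → (Fin k → Fin 2) → Fin 2
total {ℕ.zero} h = zero
total {suc k}  h = h zero ⊕ total (h ∘ suc)

prefix : ∀ {k} → (Fin k → Fin 2) → Fin k → Fin 2
prefix h zero    = zero
prefix h (suc t) = h zero ⊕ prefix (h ∘ suc) t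

∏-cong : ∀ k {f g : Fin k → ℤ} → (∀ t → f t ≡ g t) → ∏ k f ≡ ∏ k g
∏-cong ℕ.zero  _   = refl
∏-cong (suc k) f≗g = cong₂ ℤ._*_ (f≗g zero) (∏-cong k (f≗g ∘ suc))

∏-1^ : ∀ k (h : Fin k → Fin 2) → ∏ k (λ t → -1^ h t) ≡ -1^ total h
∏-1^ ℕ.zero  h = refl
∏-1^ (suc k) h = trans (cong (-1^ h zero ℤ.*_) (∏-1^ k (h ∘ suc))) (sym (-1^-⊕ (h zero) _))

prefix-suc : ∀ {k} (h : Fin (suc k) → Fin 2) (u : Fin k) →
             prefix h (suc u) ≡ prefix h (inject₁ u) ⊕ h (inject₁ u)
prefix-suc h zero    = ⊕-identityʳ (h zero)
prefix-suc h (suc u) = trans (cong (h zero ⊕_) (prefix-suc (h ∘ suc) u)) (sym (⊕-assoc (h zero) _ _))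

prefix-fromℕ : ∀ {k} (h : Fin (suc k) → Fin 2) → prefix h (fromℕ k) ⊕ h (fromℕ k) ≡ total h
prefix-fromℕ {ℕ.zero} h = sym (⊕-identityʳ (h zero))
prefix-fromℕ {suc k}  h = trans (⊕-assoc (h zero) _ _) (cong (h zero ⊕_) (prefix-fromℕ (h ∘ suc)))

prefix-next : ∀ {k} (h : Fin k → Fin 2) → total h ≡ zero → ∀ t → prefix h (next t) ≡ prefix h t ⊕ h t
prefix-next {suc k} h total≡0 t with view t
... | ‵inject₁ u = trans (cong (prefix h) (next-inject₁ u)) (prefix-suc h u)
... | ‵fromℕ     = begin
  prefix h (next (fromℕ k))          ≡⟨ cong (prefix h) (next-fromℕ k) ⟩
  zero                               ≡⟨ sym total≡0 ⟩
  total h                            ≡⟨ sym (prefix-fromℕ h) ⟩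
  prefix h (fromℕ k) ⊕ h (fromℕ k) ∎

total-increments≡0 : ∀ {k} (π h : Fin k → Fin 2) → (∀ t → π (next t) ≡ π t ⊕ h t) → total h ≡ zero
total-increments≡0 {ℕ.zero} π h _         = refl
total-increments≡0 {suc k}  π h increment = a≡a⊕b⇒b≡0 (π zero) (total h) (begin
  π zero                                             ≡⟨ cong π (sym (next-fromℕ k)) ⟩
  π (next (fromℕ k))                                 ≡⟨ increment (fromℕ k) ⟩
  π (fromℕ k) ⊕ h (fromℕ k)                          ≡⟨ cong (_⊕ h (fromℕ k)) (π≡ (fromℕ k)) ⟩
  π zero ⊕ prefix h (fromℕ k) ⊕ h (fromℕ k)          ≡⟨ ⊕-assoc (π zero) _ _ ⟩
  π zero ⊕ (prefix h (fromℕ k) ⊕ h (fromℕ k))        ≡⟨ cong (π zero ⊕_) (prefix-fromℕ h) ⟩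
  π zero ⊕ total h                                   ∎)
  where
    π≡ : ∀ t → π t ≡ π zero ⊕ prefix h t
    π≡ = <-weakInduction (λ t → π t ≡ π zero ⊕ prefix h t) (sym (⊕-identityʳ (π zero))) λ u ih → begin
      π (suc u)                                       ≡⟨ cong π (sym (next-inject₁ u)) ⟩
      π (next (inject₁ u))                            ≡⟨ increment (inject₁ u) ⟩
      π (inject₁ u) ⊕ h (inject₁ u)                   ≡⟨ cong (_⊕ h (inject₁ u)) ih ⟩
      π zero ⊕ prefix h (inject₁ u) ⊕ h (inject₁ u)   ≡⟨ ⊕-assoc (π zero) _ _ ⟩
      π zero ⊕ (prefix h (inject₁ u) ⊕ h (inject₁ u)) ≡⟨ cong (π zero ⊕_) (sym (prefix-suc h u)) ⟩
      π zero ⊕ prefix h (suc u)                       ∎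

module _ {k} (h : Fin k → Fin 2) where

  step : Fin k × Fin 2 → Fin k × Fin 2
  step (s , a) = next s , a ⊕ h s

  sheet : Fin 2 → Fin k → Fin k × Fin 2
  sheet a t = t , a ⊕ prefix h t

  sheets-injective : Injective _≡_ _≡_ (uncurry sheet)
  sheets-injective {a , t} {b , u} eq with ,-injective eq
  ... | refl , layers≡ = cong (_, t) (⊕-cancelʳ a b (prefix h t) layers≡)

  sheet-through : ∀ s b → sheet (b ⊕ prefix h s) s ≡ (s , b)
  sheet-through s b = cong (s ,_) (a⊕b⊕b≡a b (prefix h s))

  sheet-next : total h ≡ zero → ∀ a t → sheet a (next t) ≡ step (sheet a t)
  sheet-next total≡0 a t =
    cong (next t ,_) (trans (cong (a ⊕_) (prefix-next h total≡0 t)) (sym (⊕-assoc a _ _)))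

  unwind : Fin (2 * k) → Fin k × Fin 2
  unwind = uncurry sheet ∘ remQuot {2} k

  unwind-combine : ∀ (b : Fin 2) (s : Fin k) → unwind (combine b s) ≡ sheet b s
  unwind-combine b s = cong (uncurry sheet) (remQuot-combine b s)

  unwind-injective : Injective _≡_ _≡_ unwind
  unwind-injective = remQuot-injective k ∘ sheets-injective

  unwind-surjective : ∀ p → ∃ λ t → unwind t ≡ p
  unwind-surjective (s , b) =
    combine (b ⊕ prefix h s) s , trans (unwind-combine _ s) (sheet-through s b)

unwind-next-combine : ∀ {k} (h : Fin k → Fin 2) → total h ≡ suc zero →
                      ∀ (b : Fin 2) (s : Fin k) → unwind h (next (combine b s)) ≡ step h (unwind h (combine b s))
unwind-next-combine {ℕ.zero} h _ b ()
unwind-next-combine {suc k} h total≡1 b s with view s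
... | ‵inject₁ u = begin
  unwind h (next (combine b (inject₁ u)))   ≡⟨ cong (unwind h) (next-combine-inject₁ b u) ⟩
  unwind h (combine b (suc u))              ≡⟨ unwind-combine h b (suc u) ⟩
  sheet h b (suc u)                         ≡⟨ cong₂ _,_ (sym (next-inject₁ u)) layer≡ ⟩
  step h (sheet h b (inject₁ u))            ≡⟨ cong (step h) (sym (unwind-combine h b (inject₁ u))) ⟩
  step h (unwind h (combine b (inject₁ u))) ∎
  where
    layer≡ : b ⊕ prefix h (suc u) ≡ b ⊕ prefix h (inject₁ u) ⊕ h (inject₁ u)
    layer≡ = trans (cong (b ⊕_) (prefix-suc h u)) (sym (⊕-assoc b _ _))
... | ‵fromℕ = begin
  unwind h (next (combine b (fromℕ k)))     ≡⟨ cong (unwind h) (next-combine-fromℕ b) ⟩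
  unwind h (combine (b ⊕ suc zero) zero)    ≡⟨ unwind-combine h _ zero ⟩
  sheet h (b ⊕ suc zero) zero               ≡⟨ cong₂ _,_ (sym (next-fromℕ k)) layer≡ ⟩
  step h (sheet h b (fromℕ k))              ≡⟨ cong (step h) (sym (unwind-combine h b (fromℕ k))) ⟩
  step h (unwind h (combine b (fromℕ k)))   ∎
  where
    layer≡ : b ⊕ suc zero ⊕ zero ≡ b ⊕ prefix h (fromℕ k) ⊕ h (fromℕ k)
    layer≡ = begin
      b ⊕ suc zero ⊕ zero                    ≡⟨ ⊕-identityʳ _ ⟩
      b ⊕ suc zero                           ≡⟨ cong (b ⊕_) (sym total≡1) ⟩
      b ⊕ total h                            ≡⟨ cong (b ⊕_) (sym (prefix-fromℕ h)) ⟩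
      b ⊕ (prefix h (fromℕ k) ⊕ h (fromℕ k)) ≡⟨ sym (⊕-assoc b _ _) ⟩
      b ⊕ prefix h (fromℕ k) ⊕ h (fromℕ k)   ∎

unwind-next : ∀ {k} (h : Fin k → Fin 2) → total h ≡ suc zero → ∀ t → unwind h (next t) ≡ step h (unwind h t)
unwind-next {k} h total≡1 t =
  subst (λ t → unwind h (next t) ≡ step h (unwind h t)) (combine-remQuot {2} k t)
        (unwind-next-combine h total≡1 (quotient {2} k t) (remainder {2} k t))

module _ {m n} {M : GriddingMatrix m n} (C : Cycle M) where
  open Cycle C

  turn : Fin k → Fin 2
  turn t = twist (M (col t) (row t)) ⊕ twist (M (col (next t)) (row t))

  sign≡-1^total-turn : sign C ≡ -1^ total turn
  sign≡-1^total-turn = trans (∏-cong k edge-pair) (∏-1^ k turn)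
    where
      edge-pair : ∀ t → toℤ (M (col t) (row t)) ℤ.* toℤ (M (col (next t)) (row t)) ≡ -1^ turn t
      edge-pair t = trans (cong₂ ℤ._*_ (toℤ≡-1^twist _ (edgeA t)) (toℤ≡-1^twist _ (edgeB t)))
                          (sym (-1^-⊕ (twist (M (col t) (row t))) _))

sign-double≡1 : ∀ {m n} (M : GriddingMatrix m n) (D : Cycle (double M)) → sign D ≡ 1ℤ
sign-double≡1 {m} {n} M D =
  trans (sign≡-1^total-turn D) (cong -1^_ (total-increments≡0 layer (turn D) layer-next))
  where
    open Cycle D

    layer : Fin k → Fin 2
    layer t = remainder {m} 2 (col t)

    twistA twistB : Fin k → Fin 2
    twistA t = twist (M (quotient {m} 2 (col t)) (quotient {n} 2 (row t)))
    twistB t = twist (M (quotient {m} 2 (col (next t))) (quotient {n} 2 (row t)))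

    layer-next : ∀ t → layer (next t) ≡ layer t ⊕ turn D t
    layer-next t = begin
      layer (next t)                         ≡⟨ sym (a⊕b⊕b≡a _ (twistB t)) ⟩
      layer (next t) ⊕ twistB t ⊕ twistB t   ≡⟨ cong (_⊕ twistB t) (sym (layers-double M (edgeB t))) ⟩
      remainder {n} 2 (row t) ⊕ twistB t     ≡⟨ cong (_⊕ twistB t) (layers-double M (edgeA t)) ⟩
      layer t ⊕ twistA t ⊕ twistB t          ≡⟨ ⊕-assoc (layer t) _ _ ⟩
      layer t ⊕ (twistA t ⊕ twistB t)        ≡⟨ cong (layer t ⊕_) (sym (cong₂ _⊕_ (twist-double M (edgeA t))
                                                                                  (twist-double M (edgeB t)))) ⟩
      layer t ⊕ turn D t                     ∎

module Lifting {m n} {M : GriddingMatrix m n} (C : Cycle M) where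
  open Cycle C

  colLayer : Fin (m * 2) → Fin 2
  colLayer = remainder {m} 2

  rowLayer : Fin (n * 2) → Fin 2
  rowLayer = remainder {n} 2

  Position : Set
  Position = Fin k × Fin 2

  twistA twistB : Fin k → Fin 2
  twistA s = twist (M (col s) (row s))
  twistB s = twist (M (col (next s)) (row s))

  colAbove : Position → Fin (m * 2)
  colAbove (s , a) = combine (col s) a

  -- the row vertex joined to colAbove (s , a) by the lifted edge over edgeA s
  rowAbove : Position → Fin (n * 2)
  rowAbove (s , a) = combine (row s) (a ⊕ twistA s)

  VertexAbove : Position → Vertex (m * 2) (n * 2) → Set
  VertexAbove p (colV c) = colAbove p ≡ c
  VertexAbove p (rowV r) = rowAbove p ≡ r

  EdgeAbove : Position → EdgeIx (m * 2) (n * 2) → Set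
  EdgeAbove p e = (colAbove p , rowAbove p) ≡ e ⊎ (colAbove (step (turn C) p) , rowAbove p) ≡ e

  colAbove-injective : Injective _≡_ _≡_ colAbove
  colAbove-injective {s , a} {t , b} eq with combine-injective (col s) a (col t) b eq
  ... | col≡ , a≡b = cong₂ _,_ (col-inj col≡) a≡b

  rowAbove-injective : Injective _≡_ _≡_ rowAbove
  rowAbove-injective {s , a} {t , b} eq with combine-injective (row s) _ (row t) _ eq
  ... | row≡ , layers≡ with row-inj row≡
  ... | refl = cong (s ,_) (⊕-cancelʳ a b (twistA s) layers≡)

  vertexAbove-unique : ∀ {p q} v → VertexAbove p v → VertexAbove q v → p ≡ q
  vertexAbove-unique (colV c) p-above q-above = colAbove-injective (trans p-above (sym q-above))
  vertexAbove-unique (rowV r) p-above q-above = rowAbove-injective (trans p-above (sym q-above))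

  edgeA-above : ∀ p → IsEdge (double M) (colAbove p , rowAbove p)
  edgeA-above (s , a) =
    subst NonZero (sym (double-combine M (col s) a (row s) _)) (block-on-support (edgeA s) refl)

  edgeB-above : ∀ p → IsEdge (double M) (colAbove (step (turn C) p) , rowAbove p)
  edgeB-above (s , a) =
    subst NonZero (sym (double-combine M (col (next s)) _ (row s) _))
          (block-on-support (edgeB s) (begin
            a ⊕ twistA s                           ≡⟨ sym (a⊕b⊕b≡a _ (twistB s)) ⟩
            a ⊕ twistA s ⊕ twistB s ⊕ twistB s     ≡⟨ cong (_⊕ twistB s) (⊕-assoc a _ _) ⟩
            a ⊕ turn C s ⊕ twistB s                ∎))

  above⇒liftV : ∀ {p} v → VertexAbove p v → liftV C v
  above⇒liftV {s , a} (colV _) refl = s , sym (quotient-combine (col s) a)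
  above⇒liftV {s , a} (rowV _) refl = s , sym (quotient-combine (row s) _)

  above⇒liftE : ∀ {p} e → EdgeAbove p e → liftE C e
  above⇒liftE {s , a} _ (inj₁ refl) =
    (s , inj₁ (cong₂ _,_ (sym (quotient-combine _ _)) (sym (quotient-combine _ _)))) , edgeA-above (s , a)
  above⇒liftE {s , a} _ (inj₂ refl) =
    (s , inj₂ (cong₂ _,_ (sym (quotient-combine _ _)) (sym (quotient-combine _ _)))) , edgeB-above (s , a)

  colAbove-lifted : ∀ {s a c} → col s ≡ quotient {m} 2 c → a ≡ colLayer c → colAbove (s , a) ≡ c
  colAbove-lifted {c = c} col≡ a≡ = trans (cong₂ combine col≡ a≡) (combine-remQuot {m} 2 c)

  rowAbove-lifted : ∀ {s a r} → row s ≡ quotient {n} 2 r → a ⊕ twistA s ≡ rowLayer r → rowAbove (s , a) ≡ r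
  rowAbove-lifted {r = r} row≡ layer≡ = trans (cong₂ combine row≡ layer≡) (combine-remQuot {n} 2 r)

  liftV⇒above : ∀ v → liftV C v → ∃ λ p → VertexAbove p v
  liftV⇒above (colV c) (s , col≡) = (s , colLayer c) , colAbove-lifted col≡ refl
  liftV⇒above (rowV r) (s , row≡) = (s , rowLayer r ⊕ twistA s) , rowAbove-lifted row≡ (a⊕b⊕b≡a _ _)

  layers-lifted : ∀ {i j c r} → (i , j) ≡ (quotient {m} 2 c , quotient {n} 2 r) → IsEdge (double M) (c , r) →
                  rowLayer r ≡ colLayer c ⊕ twist (M i j)
  layers-lifted {c = c} eq nz =
    trans (layers-double M nz) (cong (λ p → colLayer c ⊕ twist (M (proj₁ p) (proj₂ p))) (sym eq))

  liftE⇒above : ∀ e → liftE C e → ∃ λ p → EdgeAbove p e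
  liftE⇒above (c , r) ((s , inj₁ eq) , nz) =
    (s , colLayer c) ,
    inj₁ (cong₂ _,_ (colAbove-lifted (,-injectiveˡ eq) refl)
                    (rowAbove-lifted (,-injectiveʳ eq) (sym (layers-lifted eq nz))))
  liftE⇒above (c , r) ((s , inj₂ eq) , nz) =
    (s , rowLayer r ⊕ twistA s) ,
    inj₂ (cong₂ _,_ (colAbove-lifted (,-injectiveˡ eq) layer≡)
                    (rowAbove-lifted (,-injectiveʳ eq) (a⊕b⊕b≡a _ _)))
    where
      layer≡ : rowLayer r ⊕ twistA s ⊕ turn C s ≡ colLayer c
      layer≡ = begin
        rowLayer r ⊕ twistA s ⊕ (twistA s ⊕ twistB s) ≡⟨ a⊕b⊕[b⊕c]≡a⊕c (rowLayer r) (twistA s) (twistB s) ⟩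
        rowLayer r ⊕ twistB s                          ≡⟨ cong (_⊕ twistB s) (layers-lifted eq nz) ⟩
        colLayer c ⊕ twistB s ⊕ twistB s               ≡⟨ a⊕b⊕b≡a _ _ ⟩
        colLayer c                                     ∎

  -- a cycle of G_{M×2} over C, given by the positions it visits in order
  record Lift : Set where
    field
      len                : ℕ
      2≤len              : 2 ≤ len
      position           : Fin len → Position
      position-injective : Injective _≡_ _≡_ position
      position-next      : ∀ t → position (next t) ≡ step (turn C) (position t)

  toCycle : Lift → Cycle (double M)
  toCycle D = record
    { k       = len
    ; 2≤k     = 2≤len
    ; col     = colAbove ∘ position
    ; row     = rowAbove ∘ position
    ; col-inj = λ eq → position-injective (colAbove-injective eq)
    ; row-inj = λ eq → position-injective (rowAbove-injective eq)
    ; edgeA   = edgeA-above ∘ position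
    ; edgeB   = λ t → subst (λ p → IsEdge (double M) (colAbove p , rowAbove (position t)))
                            (sym (position-next t)) (edgeB-above (position t))
    }
    where open Lift D

  Covers : Lift → Position → Set
  Covers D p = ∃ λ t → Lift.position D t ≡ p

  module _ (D : Lift) where
    open Lift D

    VSet⇒above : ∀ v → VSet (toCycle D) v → ∃ λ t → VertexAbove (position t) v
    VSet⇒above (colV _) x = x
    VSet⇒above (rowV _) x = x

    covered⇒VSet : ∀ {p} v → Covers D p → VertexAbove p v → VSet (toCycle D) v
    covered⇒VSet (colV _) (t , refl) above = t , above
    covered⇒VSet (rowV _) (t , refl) above = t , above

    edgeB-toCycle : ∀ t → (colAbove (position (next t)) , rowAbove (position t))
                        ≡ (colAbove (step (turn C) (position t)) , rowAbove (position t))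
    edgeB-toCycle t = cong (λ p → colAbove p , rowAbove (position t)) (position-next t)

    ESet⇒above : ∀ e → ESet (toCycle D) e → ∃ λ t → EdgeAbove (position t) e
    ESet⇒above e (t , x) = t , Sum.map₂ (trans (sym (edgeB-toCycle t))) x

    covered⇒ESet : ∀ {p} e → Covers D p → EdgeAbove p e → ESet (toCycle D) e
    covered⇒ESet e (t , refl) above = t , Sum.map₂ (trans (edgeB-toCycle t)) above

    VSet⇒liftV : ∀ v → VSet (toCycle D) v → liftV C v
    VSet⇒liftV v x = above⇒liftV v (proj₂ (VSet⇒above v x))

    ESet⇒liftE : ∀ e → ESet (toCycle D) e → liftE C e
    ESet⇒liftE e x = above⇒liftE e (proj₂ (ESet⇒above e x))

  module _ (D : Lift) (covers : ∀ p → Covers D p) where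

    liftV⇔VSet : ∀ v → liftV C v ⇔ VSet (toCycle D) v
    liftV⇔VSet v = mk⇔ (λ x → let p , above = liftV⇒above v x in covered⇒VSet D v (covers p) above)
                       (VSet⇒liftV D v)

    liftE⇔ESet : ∀ e → liftE C e ⇔ ESet (toCycle D) e
    liftE⇔ESet e = mk⇔ (λ x → let p , above = liftE⇒above e x in covered⇒ESet D e (covers p) above)
                       (ESet⇒liftE D e)

  module _ (D₁ D₂ : Lift) (covers : ∀ p → Covers D₁ p ⊎ Covers D₂ p) where

    liftV⇔VSet⊎VSet : ∀ v → liftV C v ⇔ (VSet (toCycle D₁) v ⊎ VSet (toCycle D₂) v)
    liftV⇔VSet⊎VSet v =
      mk⇔ (λ x → let p , above = liftV⇒above v x in
                 Sum.map (λ cov → covered⇒VSet D₁ v cov above) (λ cov → covered⇒VSet D₂ v cov above) (covers p))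
          [ VSet⇒liftV D₁ v , VSet⇒liftV D₂ v ]

    liftE⇔ESet⊎ESet : ∀ e → liftE C e ⇔ (ESet (toCycle D₁) e ⊎ ESet (toCycle D₂) e)
    liftE⇔ESet⊎ESet e =
      mk⇔ (λ x → let p , above = liftE⇒above e x in
                 Sum.map (λ cov → covered⇒ESet D₁ e cov above) (λ cov → covered⇒ESet D₂ e cov above) (covers p))
          [ ESet⇒liftE D₁ e , ESet⇒liftE D₂ e ]

  module Sheets (total≡0 : total (turn C) ≡ zero) where

    sheetLift : Fin 2 → Lift
    sheetLift a = record
      { len                = k
      ; 2≤len              = 2≤k
      ; position           = sheet (turn C) a
      ; position-injective = ,-injectiveˡ
      ; position-next      = sheet-next (turn C) total≡0 a
      }

    sheets-cover : ∀ p → Covers (sheetLift zero) p ⊎ Covers (sheetLift (suc zero)) p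
    sheets-cover (s , b) = Fin2-⊎ (λ a → Covers (sheetLift a) (s , b)) (b ⊕ prefix (turn C) s)
                                  (s , sheet-through (turn C) s b)

    sheetLift-unique : ∀ {a b} v → VSet (toCycle (sheetLift a)) v → VSet (toCycle (sheetLift b)) v → a ≡ b
    sheetLift-unique v x y with VSet⇒above (sheetLift _) v x | VSet⇒above (sheetLift _) v y
    ... | s , s-above | t , t-above =
      ,-injectiveˡ (sheets-injective (turn C) (vertexAbove-unique v s-above t-above))

  module Unwound (total≡1 : total (turn C) ≡ suc zero) where

    unwoundLift : Lift
    unwoundLift = record
      { len                = 2 * k
      ; 2≤len              = ≤-trans 2≤k (m≤m+n k _)
      ; position           = unwind (turn C)
      ; position-injective = unwind-injective (turn C)
      ; position-next      = unwind-next (turn C) total≡1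
      }

proposition2p3 : ∀ {m n : ℕ} (M : GriddingMatrix m n) (C : Cycle M) →
    (sign C ≡ 1ℤ →
      Σ (Cycle (double M)) λ C₁ → Σ (Cycle (double M)) λ C₂ →
        cycleLength C₁ ≡ cycleLength C × cycleLength C₂ ≡ cycleLength C
        × sign C₁ ≡ 1ℤ × sign C₂ ≡ 1ℤ
        × (∀ v → VSet C₁ v → VSet C₂ v → ⊥)
        × (∀ v → liftV C v ⇔ (VSet C₁ v ⊎ VSet C₂ v))
        × (∀ e → liftE C e ⇔ (ESet C₁ e ⊎ ESet C₂ e)))
    × (sign C ≡ -1ℤ →
      Σ (Cycle (double M)) λ C′ →
        cycleLength C′ ≡ 2 * cycleLength C
        × sign C′ ≡ 1ℤ
        × (∀ v → liftV C v ⇔ VSet C′ v)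
        × (∀ e → liftE C e ⇔ ESet C′ e))
proposition2p3 M C =
  (λ sign≡1 →
    let open Sheets (-1^≡1⇒≡0 _ (trans (sym (sign≡-1^total-turn C)) sign≡1)) in
    toCycle (sheetLift zero) , toCycle (sheetLift (suc zero)) , refl , refl ,
    sign-double≡1 M (toCycle (sheetLift zero)) , sign-double≡1 M (toCycle (sheetLift (suc zero))) ,
    (λ v x y → 0≢1+n (sheetLift-unique v x y)) ,
    liftV⇔VSet⊎VSet (sheetLift zero) (sheetLift (suc zero)) sheets-cover ,
    liftE⇔ESet⊎ESet (sheetLift zero) (sheetLift (suc zero)) sheets-cover) ,
  (λ sign≡-1 →
    let open Unwound (-1^≡-1⇒≡1 _ (trans (sym (sign≡-1^total-turn C)) sign≡-1)) in
    toCycle unwoundLift , refl , sign-double≡1 M (toCycle unwoundLift) ,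
    liftV⇔VSet unwoundLift (unwind-surjective (turn C)) , liftE⇔ESet unwoundLift (unwind-surjective (turn C)))
  where open Lifting C
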